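{- Let $n\ge 2$ and $m\ge 1$ be integers and let $\tilde{H}(n,m)\subset\mathbb{R}^{mn}$ be the Euclidean representation of the Hamming scheme described in the context. For each $j\in\{1,\ldots,m\}$ let $t_j$ be an integer with $1\le t_j\le m$, let $k_1^{(j)},\ldots,k_{t_j}^{(j)}$ be nonnegative integers with $\sum_{i=1}^{t_j}k_i^{(j)}=n$, and put $k_0^{(j)}=1+\sum_{i=1}^{t_j}(i-1)k_i^{(j)}$. Let $\mathfrak{X}=\mathfrak{x}_1\times\cdots\times\mathfrak{x}_m\subset\mathbb{R}^{mn}$ be the associated set and $M_{\mathfrak{X}}=\max_{\mathbf{y}\in\tilde{H}(n,m)}d(\mathbf{x},\mathbf{y})^2$ for $\mathbf{x}\in\mathfrak{X}$ (this value does not depend on the choice of $\mathbf{x}\in\mathfrak{X}$). Then every vector $\mathbf{x}\in\mathfrak{X}$ can be added to $\tilde{H}(n,m)$ while maintaining $m$-distance (i.e. $\tilde{H}(n,m)\cup\{\mathbf{x}\}$ is still an $m$-distance set) if and only if $M_{\mathfrak{X}}$ is an even positive integer less than or equal to $2m$.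
   Context: $\mathbf{e}_1,\ldots,\mathbf{e}_{mn}$ is the standard basis of $\mathbb{R}^{mn}$ and $d(\cdot,\cdot)$ is the Euclidean distance. $\tilde{H}(n,m)=\{\sum_{i=1}^m\mathbf{e}_{(i-1)n+x_i} : (x_1,\ldots,x_m)\in\{1,\ldots,n\}^m\}$; its squared distances between distinct points are exactly $2,4,\ldots,2m$. A finite set $X\subset\mathbb{R}^N$ is an $m$-distance set if the set of Euclidean distances between distinct points of $X$ has exactly $m$ elements. Vectors of $\mathbb{R}^{mn}$ are written as $(\mathbf{x}_1,\ldots,\mathbf{x}_m)$ with blocks $\mathbf{x}_j\in\mathbb{R}^n$. For each $j$, $\mathfrak{x}_j\subset\mathbb{R}^n$ is the set of all vectors obtained by permuting the coordinates of the vector having $k_1^{(j)}$ entries equal to $k_0^{(j)}/n$, $k_2^{(j)}$ entries equal to $k_0^{(j)}/n-1$, ..., $k_{t_j}^{(j)}$ entries equal to $k_0^{(j)}/n-t_j+1$; and $\mathfrak{X}=\{(\mathbf{x}_1,\ldots,\mathbf{x}_m):\mathbf{x}_j\in\mathfrak{x}_j\}$. -}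

module Defs where

open import Data.Nat as ℕ using (ℕ; zero; suc)
open import Data.Integer as ℤ using (+_)
open import Data.Rational as ℚ using (ℚ; 0ℚ; 1ℚ; _/_)
open import Data.Fin using (Fin; toℕ; _≟_)
open import Data.List using (List; length)
open import Data.List.Relation.Unary.Unique.Propositional using (Unique)
open import Data.List.Membership.Propositional using (_∈_)
open import Data.Product using (Σ; ∃; _×_; _,_)
open import Data.Sum using (_⊎_)
open import Relation.Nullary using (¬_; yes; no)
open import Relation.Binary.PropositionalEquality using (_≡_)

Σℚ : (n : ℕ) → (Fin n → ℚ) → ℚ
Σℚ zero    f = 0ℚ
Σℚ (suc n) f = f Data.Fin.zero ℚ.+ Σℚ n (λ i → f (Data.Fin.suc i))

Σℕ : (n : ℕ) → (Fin n → ℕ) → ℕ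
Σℕ zero    f = 0
Σℕ (suc n) f = f Data.Fin.zero ℕ.+ Σℕ n (λ i → f (Data.Fin.suc i))

count : {n t : ℕ} → (Fin n → Fin t) → Fin t → ℕ
count {n} c i = Σℕ n (λ p → indic (c p ≟ i))
  where
  indic : ∀ {A : Set} → Relation.Nullary.Dec A → ℕ
  indic (yes _) = 1
  indic (no _)  = 0

-- a / n as a rational (n ≥ 2 in all uses; the n = 0 case is a dummy).
_/ℕ_ : ℕ → ℕ → ℚ
a /ℕ zero  = 0ℚ
a /ℕ suc n = (+ a) / suc n

ℕ→ℚ : ℕ → ℚ
ℕ→ℚ a = (+ a) / 1

-- Points of ℝ^{mn} with rational coordinates, written in m blocks of length n.
Point : ℕ → ℕ → Set
Point m n = Fin m → Fin n → ℚ

_≈P_ : ∀ {m n} → Point m n → Point m n → Set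
x ≈P y = ∀ a b → x a b ≡ y a b

sqDist : ∀ {m n} → Point m n → Point m n → ℚ
sqDist {m} {n} x y =
  Σℚ m (λ a → Σℚ n (λ b → (x a b ℚ.- y a b) ℚ.* (x a b ℚ.- y a b)))

-- The vector Σ_i e_{(i-1)n + x_i}: block a has a 1 in coordinate f a.
hamPt : ∀ {m n} → (Fin m → Fin n) → Point m n
hamPt f a b with f a ≟ b
... | yes _ = 1ℚ
... | no _  = 0ℚ

InH : (m n : ℕ) → Point m n → Set
InH m n z = ∃ λ (f : Fin m → Fin n) → z ≈P hamPt f

-- Since distances are
-- nonnegative, two distances agree iff their squares agree, so we count
-- squared distances: there is a duplicate-free list of exactly s values that
-- is precisely the set of squared distances between distinct points of S.
IsDistSet : ∀ {m n} → (Point m n → Set) → ℕ → Set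
IsDistSet {m} {n} S s =
  Σ (List ℚ) λ D →
    length D ≡ s × Unique D ×
    (∀ x y → S x → S y → ¬ (x ≈P y) → sqDist x y ∈ D) ×
    (∀ d → d ∈ D → Σ (Point m n) λ x → Σ (Point m n) λ y →
        S x × S y × ¬ (x ≈P y) × sqDist x y ≡ d)

-- k₀ = 1 + Σ_{i=1}^{t} (i-1) k_i  (index i : Fin t stands for i+1).
k0 : (t : ℕ) → (Fin t → ℕ) → ℕ
k0 t k = suc (Σℕ t (λ i → toℕ i ℕ.* k i))

-- v ∈ 𝔵 for data (t, k): v is a coordinate permutation of the vector having
-- k_i entries equal to k₀/n - (i-1), i = 1..t.
InX1 : (n t : ℕ) → (Fin t → ℕ) → (Fin n → ℚ) → Set
InX1 n t k v =
  Σ (Fin n → Fin t) λ c →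
    (∀ i → count c i ≡ k i) ×
    (∀ p → v p ≡ (k0 t k /ℕ n) ℚ.- ℕ→ℚ (toℕ (c p)))

InX : (m n : ℕ) → (t : Fin m → ℕ) → ((j : Fin m) → Fin (t j) → ℕ) → Point m n → Set
InX m n t k x = ∀ j → InX1 n (t j) (k j) (x j)

HamUnion : (m n : ℕ) → Point m n → Point m n → Set
HamUnion m n x z = InH m n z ⊎ z ≈P x

IsMaxSqDist : (m n : ℕ) → Point m n → ℚ → Set
IsMaxSqDist m n x M =
  (∃ λ (f : Fin m → Fin n) → sqDist x (hamPt f) ≡ M) ×
  (∀ (f : Fin m → Fin n) → sqDist x (hamPt f) ℚ.≤ M)

-- For any point x, d(x, h_f)² = Σ_a (|x_a|² + 1 − 2 x_a(f_a)).  Between points of H̃(n,m)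
-- this is twice the Hamming distance, so H̃(n,m) alone already realises all of 2, 4, …, 2m;
-- hence H̃(n,m) ∪ {x} is an m-distance set exactly when every d(x,y)², y ∈ H̃(n,m), y ≠ x,
-- is one of them.  For x ∈ 𝔛 the j-th block contributes a constant plus twice the level
-- (i − 1) of the coordinate picked by f, and every x ∈ 𝔛 has the same level multiplicities,
-- so the squared distances from x to H̃(n,m) are all of the form M − 2d with d ∈ ℕ.  If M is
-- an even number in [2, 2m] these are even numbers in [0, 2m], and nonzero for y ≠ x.
-- Conversely M is itself attained at a Hamming point, which differs from x because n ≥ 2.
module Submission where

open import Defs
open import Data.Nat as ℕ using (ℕ; zero; suc; z≤n; s≤s)
import Data.Nat.Properties as ℕP
import Data.Integer as ℤ
import Data.Integer.Properties as ℤP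
import Data.Nat.Coprimality as Coprime
open import Data.Rational as ℚ using (ℚ; 0ℚ; 1ℚ; mkℚ; _+_; _*_; _-_; -_; _≤_)
import Data.Rational.Properties as ℚP
open import Data.Fin as Fin using (Fin; toℕ)
open import Data.Product using (Σ; ∃; ∃₂; _×_; _,_; proj₁; proj₂)
open import Data.Sum using (inj₁; inj₂)
open import Data.Empty using (⊥-elim)
open import Data.List using (List; _∷_; length; applyUpTo)
import Data.List.Properties as List
open import Data.List.Membership.Propositional using (_∈_)
open import Data.List.Membership.Propositional.Properties using (∈-applyUpTo⁺; ∈-applyUpTo⁻)
open import Data.List.Relation.Unary.Any as Any using (here; there)
import Data.List.Relation.Unary.All as All
open import Data.List.Relation.Unary.AllPairs using ([]; _∷_)
open import Data.List.Relation.Unary.Unique.Propositional using (Unique)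
open import Data.List.Relation.Unary.Unique.Propositional.Properties using (applyUpTo⁺₁)
open import Data.List.Relation.Binary.Subset.Propositional using (_⊆_)
open import Level using (0ℓ)
open import Relation.Nullary using (¬_; yes; no)
open import Relation.Binary.Definitions using (DecidableEquality)
open import Relation.Nullary.Decidable using (dec⇒maybe)
open import Relation.Binary.PropositionalEquality
open import Function.Base using (_∘_)
open import Function.Bundles using (_⇔_; mk⇔)
import Tactic.RingSolver.Core.AlmostCommutativeRing as ACR
open import Tactic.RingSolver using (solve-∀)

ℚ-ring : ACR.AlmostCommutativeRing 0ℓ 0ℓ
ℚ-ring = ACR.fromCommutativeRing ℚP.+-*-commutativeRing (λ x → dec⇒maybe (0ℚ ℚP.≟ x))

private
  variable
    m n t : ℕ

ℕ→ℚ≡mkℚ : ∀ a → ℕ→ℚ a ≡ mkℚ (ℤ.+ a) 0 (Coprime.sym (Coprime.1-coprimeTo a))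
ℕ→ℚ≡mkℚ a = ℚP.↥p/↧p≡p _

ℕ→ℚ-+ : ∀ a b → ℕ→ℚ (a ℕ.+ b) ≡ ℕ→ℚ a + ℕ→ℚ b
ℕ→ℚ-+ a b = sym (begin
  ℕ→ℚ a + ℕ→ℚ b
    ≡⟨ cong₂ _+_ (ℕ→ℚ≡mkℚ a) (ℕ→ℚ≡mkℚ b) ⟩
  (ℤ.+ a ℤ.* ℤ.+ 1 ℤ.+ ℤ.+ b ℤ.* ℤ.+ 1) ℚ./ 1
    ≡⟨ cong (ℚ._/ 1) (cong₂ ℤ._+_ (ℤP.*-identityʳ (ℤ.+ a)) (ℤP.*-identityʳ (ℤ.+ b))) ⟩
  ℕ→ℚ (a ℕ.+ b) ∎)
  where open ≡-Reasoning

ℕ→ℚ-double : ∀ a → ℕ→ℚ (2 ℕ.* a) ≡ ℕ→ℚ a + ℕ→ℚ a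
ℕ→ℚ-double a = trans (ℕ→ℚ-+ a (a ℕ.+ 0)) (cong (λ b → ℕ→ℚ a + ℕ→ℚ b) (ℕP.+-identityʳ a))

ℕ→ℚ-injective : ∀ {a b} → ℕ→ℚ a ≡ ℕ→ℚ b → a ≡ b
ℕ→ℚ-injective {a} {b} eq = ℤP.+-injective (cong ℚ.↥_ (trans (sym (ℕ→ℚ≡mkℚ a)) (trans eq (ℕ→ℚ≡mkℚ b))))

ℕ→ℚ-cancel-≤ : ∀ {a b} → ℕ→ℚ a ≤ ℕ→ℚ b → a ℕ.≤ b
ℕ→ℚ-cancel-≤ {a} {b} le with subst₂ _≤_ (ℕ→ℚ≡mkℚ a) (ℕ→ℚ≡mkℚ b) le
... | ℚ.*≤* le′ = ℤP.drop‿+≤+ (subst₂ ℤ._≤_ (ℤP.*-identityʳ (ℤ.+ a)) (ℤP.*-identityʳ (ℤ.+ b)) le′)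

+-ℕ→ℚ⇒≡∸ : ∀ {p} a b → 0ℚ ≤ p → p + ℕ→ℚ a ≡ ℕ→ℚ b → p ≡ ℕ→ℚ (b ℕ.∸ a)
+-ℕ→ℚ⇒≡∸ {p} a b 0≤p eq = begin
  p                                ≡⟨ cancel p (ℕ→ℚ a) ⟩
  (p + ℕ→ℚ a) - ℕ→ℚ a              ≡⟨ cong (_- ℕ→ℚ a) (trans eq (cong ℕ→ℚ (sym b∸a+a≡b))) ⟩
  ℕ→ℚ (b ℕ.∸ a ℕ.+ a) - ℕ→ℚ a      ≡⟨ cong (_- ℕ→ℚ a) (ℕ→ℚ-+ (b ℕ.∸ a) a) ⟩
  (ℕ→ℚ (b ℕ.∸ a) + ℕ→ℚ a) - ℕ→ℚ a  ≡⟨ cancel (ℕ→ℚ (b ℕ.∸ a)) (ℕ→ℚ a) ⟨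
  ℕ→ℚ (b ℕ.∸ a)                    ∎
  where
  open ≡-Reasoning
  cancel : ∀ x y → x ≡ (x + y) - y
  cancel = solve-∀ ℚ-ring
  a≤b : a ℕ.≤ b
  a≤b = ℕ→ℚ-cancel-≤ (subst₂ _≤_ (ℚP.+-identityˡ (ℕ→ℚ a)) eq (ℚP.+-monoˡ-≤ (ℕ→ℚ a) 0≤p))
  b∸a+a≡b : b ℕ.∸ a ℕ.+ a ≡ b
  b∸a+a≡b = ℕP.m∸n+n≡m a≤b

Σℚ-cong : ∀ n {f g : Fin n → ℚ} → (∀ i → f i ≡ g i) → Σℚ n f ≡ Σℚ n g
Σℚ-cong zero    f≗g = refl
Σℚ-cong (suc n) f≗g = cong₂ _+_ (f≗g Fin.zero) (Σℚ-cong n (f≗g ∘ Fin.suc))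

Σℕ-cong : ∀ n {f g : Fin n → ℕ} → (∀ i → f i ≡ g i) → Σℕ n f ≡ Σℕ n g
Σℕ-cong zero    f≗g = refl
Σℕ-cong (suc n) f≗g = cong₂ ℕ._+_ (f≗g Fin.zero) (Σℕ-cong n (f≗g ∘ Fin.suc))

Σℚ-+ : ∀ n (f g : Fin n → ℚ) → Σℚ n (λ i → f i + g i) ≡ Σℚ n f + Σℚ n g
Σℚ-+ zero    f g = sym (ℚP.+-identityʳ 0ℚ)
Σℚ-+ (suc n) f g = trans (cong ((f Fin.zero + g Fin.zero) +_) (Σℚ-+ n (f ∘ Fin.suc) (g ∘ Fin.suc)))
                         (interchange (f Fin.zero) (g Fin.zero) (Σℚ n (f ∘ Fin.suc)) (Σℚ n (g ∘ Fin.suc)))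
  where
  interchange : ∀ a b c d → (a + b) + (c + d) ≡ (a + c) + (b + d)
  interchange = solve-∀ ℚ-ring

Σℚ-0 : ∀ n → Σℚ n (λ _ → 0ℚ) ≡ 0ℚ
Σℚ-0 zero    = refl
Σℚ-0 (suc n) = trans (ℚP.+-identityˡ _) (Σℚ-0 n)

ℕ→ℚ-Σℕ : ∀ n (f : Fin n → ℕ) → ℕ→ℚ (Σℕ n f) ≡ Σℚ n (ℕ→ℚ ∘ f)
ℕ→ℚ-Σℕ zero    f = refl
ℕ→ℚ-Σℕ (suc n) f = trans (ℕ→ℚ-+ (f Fin.zero) _) (cong (ℕ→ℚ (f Fin.zero) +_) (ℕ→ℚ-Σℕ n (f ∘ Fin.suc)))

Σℕ-*ˡ : ∀ n c (f : Fin n → ℕ) → Σℕ n (λ i → c ℕ.* f i) ≡ c ℕ.* Σℕ n f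
Σℕ-*ˡ zero    c f = sym (ℕP.*-zeroʳ c)
Σℕ-*ˡ (suc n) c f = trans (cong (c ℕ.* f Fin.zero ℕ.+_) (Σℕ-*ˡ n c (f ∘ Fin.suc)))
                          (sym (ℕP.*-distribˡ-+ c (f Fin.zero) _))

Σℕ-≤ : ∀ n (f : Fin n → ℕ) → (∀ i → f i ℕ.≤ 1) → Σℕ n f ℕ.≤ n
Σℕ-≤ zero    f f≤1 = z≤n
Σℕ-≤ (suc n) f f≤1 = ℕP.+-mono-≤ (f≤1 Fin.zero) (Σℕ-≤ n (f ∘ Fin.suc) (f≤1 ∘ Fin.suc))

+-nonneg-≡0ˡ : ∀ {p q} → 0ℚ ≤ p → 0ℚ ≤ q → p + q ≡ 0ℚ → p ≡ 0ℚ
+-nonneg-≡0ˡ {p} 0≤p 0≤q p+q≡0 = ℚP.≤-antisym (subst₂ _≤_ (ℚP.+-identityʳ p) p+q≡0 (ℚP.+-monoʳ-≤ p 0≤q)) 0≤p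

Σℚ-nonneg : ∀ n (f : Fin n → ℚ) → (∀ i → 0ℚ ≤ f i) → 0ℚ ≤ Σℚ n f
Σℚ-nonneg zero    f 0≤f = ℚP.≤-refl
Σℚ-nonneg (suc n) f 0≤f = ℚP.+-mono-≤ (0≤f Fin.zero) (Σℚ-nonneg n (f ∘ Fin.suc) (0≤f ∘ Fin.suc))

Σℚ-nonneg-≡0 : ∀ n (f : Fin n → ℚ) → (∀ i → 0ℚ ≤ f i) → Σℚ n f ≡ 0ℚ → ∀ i → f i ≡ 0ℚ
Σℚ-nonneg-≡0 (suc n) f 0≤f Σ≡0 = go
  where
  0≤tail = Σℚ-nonneg n (f ∘ Fin.suc) (0≤f ∘ Fin.suc)
  head≡0 = +-nonneg-≡0ˡ (0≤f Fin.zero) 0≤tail Σ≡0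
  tail≡0 : Σℚ n (f ∘ Fin.suc) ≡ 0ℚ
  tail≡0 = +-nonneg-≡0ˡ 0≤tail (0≤f Fin.zero) (trans (ℚP.+-comm _ (f Fin.zero)) Σ≡0)
  go : ∀ i → f i ≡ 0ℚ
  go Fin.zero    = head≡0
  go (Fin.suc i) = Σℚ-nonneg-≡0 n (f ∘ Fin.suc) (0≤f ∘ Fin.suc) tail≡0 i

sq-nonneg : ∀ p → 0ℚ ≤ p * p
sq-nonneg p with ℚP.≤-total 0ℚ p
... | inj₁ 0≤p = ℚP.nonNegative⁻¹ _ {{ℚP.nonNeg*nonNeg⇒nonNeg p {{ℚ.nonNegative 0≤p}} p {{ℚ.nonNegative 0≤p}}}}
... | inj₂ p≤0 = ℚP.nonNegative⁻¹ _ {{ℚP.nonPos*nonPos⇒nonPos p {{ℚ.nonPositive p≤0}} p {{ℚ.nonPositive p≤0}}}}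

sq≡0⇒≡0 : ∀ p → p * p ≡ 0ℚ → p ≡ 0ℚ
sq≡0⇒≡0 p p²≡0 with p ℚP.≟ 0ℚ
... | yes p≡0 = p≡0
... | no  p≢0 = ⊥-elim (ℚP.1≢0 (begin
  1ℚ                      ≡⟨ cong₂ _*_ inverse inverse ⟨
  (p * p⁻¹) * (p * p⁻¹)   ≡⟨ regroup p p⁻¹ ⟩
  (p * p) * (p⁻¹ * p⁻¹)   ≡⟨ cong (_* (p⁻¹ * p⁻¹)) p²≡0 ⟩
  0ℚ * (p⁻¹ * p⁻¹)        ≡⟨ ℚP.*-zeroˡ (p⁻¹ * p⁻¹) ⟩
  0ℚ                      ∎))
  where
  open ≡-Reasoning
  instance _ = ℚ.≢-nonZero p≢0
  p⁻¹ = ℚ.1/ p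
  inverse : p * p⁻¹ ≡ 1ℚ
  inverse = ℚP.*-inverseʳ p
  regroup : ∀ a b → (a * b) * (a * b) ≡ (a * a) * (b * b)
  regroup = solve-∀ ℚ-ring

module _ {a} {A : Set a} where

  ∈-─ : {x y : A} {xs : List A} (x∈xs : x ∈ xs) → y ∈ xs → y ≢ x → y ∈ (xs Any.─ x∈xs)
  ∈-─ (here refl)  (here refl)  y≢x = ⊥-elim (y≢x refl)
  ∈-─ (here refl)  (there y∈xs) y≢x = y∈xs
  ∈-─ (there x∈xs) (here refl)  y≢x = here refl
  ∈-─ (there x∈xs) (there y∈xs) y≢x = there (∈-─ x∈xs y∈xs y≢x)

  Unique-⊆⇒length-≤ : {xs ys : List A} → Unique xs → xs ⊆ ys → length xs ℕ.≤ length ys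
  Unique-⊆⇒length-≤ []                      xs⊆ys = z≤n
  Unique-⊆⇒length-≤ {x ∷ xs} {ys} (x∉xs ∷ u) xs⊆ys =
    subst (suc (length xs) ℕ.≤_) (sym (List.length-removeAt′ ys (Any.index x∈ys)))
      (s≤s (Unique-⊆⇒length-≤ u λ y∈xs →
        ∈-─ x∈ys (xs⊆ys (there y∈xs)) (λ y≡x → All.lookup x∉xs y∈xs (sym y≡x))))
    where x∈ys = xs⊆ys (here refl)

  Unique-⊆-length⇒⊇ : DecidableEquality A → {xs ys : List A} →
    Unique xs → xs ⊆ ys → length ys ℕ.≤ length xs → ys ⊆ xs
  Unique-⊆-length⇒⊇ _≟_ {xs} {ys} u xs⊆ys |ys|≤|xs| {y} y∈ys with Any.any? (y ≟_) xs
  ... | yes y∈xs = y∈xs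
  ... | no  y∉xs = ⊥-elim (ℕP.<-irrefl refl (ℕP.≤-trans |y∷xs|≤|ys| |ys|≤|xs|))
    where
    |y∷xs|≤|ys| : length (y ∷ xs) ℕ.≤ length ys
    |y∷xs|≤|ys| = Unique-⊆⇒length-≤
      (All.tabulate (λ z∈xs y≡z → y∉xs (subst (_∈ xs) (sym y≡z) z∈xs)) ∷ u)
      λ { (here refl) → y∈ys ; (there z∈xs) → xs⊆ys z∈xs }

-- Squared distances to Hamming points

sqNorm : (Fin n → ℚ) → ℚ
sqNorm {n} v = Σℚ n (λ b → v b * v b)

unitVec : Fin n → Fin n → ℚ
unitVec q b with q Fin.≟ b
... | yes _ = 1ℚ
... | no  _ = 0ℚ

unitVec-suc : (q b : Fin n) → unitVec (Fin.suc q) (Fin.suc b) ≡ unitVec q b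
unitVec-suc q b with q Fin.≟ b
... | yes _ = refl
... | no  _ = refl

unitVec-diag : (q : Fin n) → unitVec q q ≡ 1ℚ
unitVec-diag q with q Fin.≟ q
... | yes _   = refl
... | no  q≢q = ⊥-elim (q≢q refl)

unitVec≡1⇒≡ : {q b : Fin n} → unitVec q b ≡ 1ℚ → q ≡ b
unitVec≡1⇒≡ {q = q} {b} eq with q Fin.≟ b
... | yes q≡b = q≡b
... | no  _   = ⊥-elim (ℚP.1≢0 (sym eq))

hamPt≡unitVec : (f : Fin m → Fin n) → ∀ a b → hamPt f a b ≡ unitVec (f a) b
hamPt≡unitVec f a b with f a Fin.≟ b
... | yes _ = refl
... | no  _ = refl

Σℚ-unitVec-* : ∀ n (q : Fin n) (w : Fin n → ℚ) → Σℚ n (λ b → unitVec q b * w b) ≡ w q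
Σℚ-unitVec-* (suc n) Fin.zero w = begin
  1ℚ * w Fin.zero + Σℚ n (λ b → unitVec Fin.zero (Fin.suc b) * w (Fin.suc b))
    ≡⟨ cong (1ℚ * w Fin.zero +_) (trans (Σℚ-cong n (λ b → ℚP.*-zeroˡ (w (Fin.suc b)))) (Σℚ-0 n)) ⟩
  1ℚ * w Fin.zero + 0ℚ
    ≡⟨ trans (ℚP.+-identityʳ _) (ℚP.*-identityˡ _) ⟩
  w Fin.zero ∎
  where open ≡-Reasoning
Σℚ-unitVec-* (suc n) (Fin.suc q) w = begin
  0ℚ * w Fin.zero + Σℚ n (λ b → unitVec (Fin.suc q) (Fin.suc b) * w (Fin.suc b))
    ≡⟨ cong₂ _+_ (ℚP.*-zeroˡ (w Fin.zero)) (Σℚ-cong n (λ b → cong (_* w (Fin.suc b)) (unitVec-suc q b))) ⟩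
  0ℚ + Σℚ n (λ b → unitVec q b * w (Fin.suc b))
    ≡⟨ trans (ℚP.+-identityˡ _) (Σℚ-unitVec-* n q (w ∘ Fin.suc)) ⟩
  w (Fin.suc q) ∎
  where open ≡-Reasoning

sqNorm-unitVec : (q : Fin n) → sqNorm (unitVec q) ≡ 1ℚ
sqNorm-unitVec {n} q = trans (Σℚ-unitVec-* n q (unitVec q)) (unitVec-diag q)

sq-sub-unitVec : ∀ c (q b : Fin n) →
  (c - unitVec q b) * (c - unitVec q b) ≡ c * c + unitVec q b * (1ℚ - (c + c))
sq-sub-unitVec c q b with q Fin.≟ b
... | yes _ = sub1 c
  where
  sub1 : ∀ c → (c - 1ℚ) * (c - 1ℚ) ≡ c * c + 1ℚ * (1ℚ - (c + c))
  sub1 = solve-∀ ℚ-ring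
... | no _ = sub0 c
  where
  sub0 : ∀ c → (c - 0ℚ) * (c - 0ℚ) ≡ c * c + 0ℚ * (1ℚ - (c + c))
  sub0 = solve-∀ ℚ-ring

sqNorm-sub-unitVec : (v : Fin n → ℚ) (q : Fin n) →
  sqNorm (λ b → v b - unitVec q b) ≡ sqNorm v + (1ℚ - (v q + v q))
sqNorm-sub-unitVec {n} v q = begin
  Σℚ n (λ b → (v b - unitVec q b) * (v b - unitVec q b))
    ≡⟨ Σℚ-cong n (λ b → sq-sub-unitVec (v b) q b) ⟩
  Σℚ n (λ b → v b * v b + unitVec q b * (1ℚ - (v b + v b)))
    ≡⟨ Σℚ-+ n _ _ ⟩
  sqNorm v + Σℚ n (λ b → unitVec q b * (1ℚ - (v b + v b)))
    ≡⟨ cong (sqNorm v +_) (Σℚ-unitVec-* n q (λ b → 1ℚ - (v b + v b))) ⟩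
  sqNorm v + (1ℚ - (v q + v q)) ∎
  where open ≡-Reasoning

sqDist-hamPt : (x : Point m n) (f : Fin m → Fin n) →
  sqDist x (hamPt f) ≡ Σℚ m (λ a → sqNorm (x a) + (1ℚ - (x a (f a) + x a (f a))))
sqDist-hamPt {m} {n} x f = Σℚ-cong m λ a → trans
  (Σℚ-cong n (λ b → cong (λ y → (x a b - y) * (x a b - y)) (hamPt≡unitVec f a b)))
  (sqNorm-sub-unitVec (x a) (f a))

≈P-refl : {x : Point m n} → x ≈P x
≈P-refl a b = refl

≈P-sym : {x y : Point m n} → x ≈P y → y ≈P x
≈P-sym x≈y a b = sym (x≈y a b)

≈P-trans : {x y z : Point m n} → x ≈P y → y ≈P z → x ≈P z
≈P-trans x≈y y≈z a b = trans (x≈y a b) (y≈z a b)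

sqDist-cong : {x x′ y y′ : Point m n} → x ≈P x′ → y ≈P y′ → sqDist x y ≡ sqDist x′ y′
sqDist-cong {m} {n} x≈x′ y≈y′ = Σℚ-cong m λ a → Σℚ-cong n λ b →
  cong₂ (λ p q → (p - q) * (p - q)) (x≈x′ a b) (y≈y′ a b)

sqDist-sym : (x y : Point m n) → sqDist x y ≡ sqDist y x
sqDist-sym {m} {n} x y = Σℚ-cong m λ a → Σℚ-cong n λ b → swap (x a b) (y a b)
  where
  swap : ∀ p q → (p - q) * (p - q) ≡ (q - p) * (q - p)
  swap = solve-∀ ℚ-ring

sqDist-nonneg : (x y : Point m n) → 0ℚ ≤ sqDist x y
sqDist-nonneg {m} {n} x y =
  Σℚ-nonneg m _ λ a → Σℚ-nonneg n _ λ b → sq-nonneg (x a b - y a b)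

sqDist≡0⇒≈P : (x y : Point m n) → sqDist x y ≡ 0ℚ → x ≈P y
sqDist≡0⇒≈P {m} {n} x y d≡0 a b = begin
  x a b                   ≡⟨ sub-add (x a b) (y a b) ⟩
  (x a b - y a b) + y a b ≡⟨ cong (_+ y a b) (sq≡0⇒≡0 (x a b - y a b) diff²≡0) ⟩
  0ℚ + y a b              ≡⟨ ℚP.+-identityˡ (y a b) ⟩
  y a b                   ∎
  where
  open ≡-Reasoning
  sub-add : ∀ p q → p ≡ (p - q) + q
  sub-add = solve-∀ ℚ-ring
  row : Fin m → ℚ
  row a = sqNorm (λ b → x a b - y a b)
  row≡0 : row a ≡ 0ℚ
  row≡0 = Σℚ-nonneg-≡0 m row (λ a → Σℚ-nonneg n _ λ b → sq-nonneg (x a b - y a b)) d≡0 a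
  diff²≡0 : (x a b - y a b) * (x a b - y a b) ≡ 0ℚ
  diff²≡0 = Σℚ-nonneg-≡0 n _ (λ b → sq-nonneg (x a b - y a b)) row≡0 b

≈P⇒sqDist≡0 : {x y : Point m n} → x ≈P y → sqDist x y ≡ 0ℚ
≈P⇒sqDist≡0 {m} {n} {x} {y} x≈y = begin
  sqDist x y                 ≡⟨ sqDist-cong x≈y ≈P-refl ⟩
  sqDist y y                 ≡⟨ Σℚ-cong m (λ a → Σℚ-cong n λ b → sub-self (y a b)) ⟩
  Σℚ m (λ _ → Σℚ n λ _ → 0ℚ) ≡⟨ trans (Σℚ-cong m λ _ → Σℚ-0 n) (Σℚ-0 m) ⟩
  0ℚ                         ∎
  where
  open ≡-Reasoning
  sub-self : ∀ p → (p - p) * (p - p) ≡ 0ℚ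
  sub-self = solve-∀ ℚ-ring

hamPt-injective : {f g : Fin m → Fin n} → hamPt f ≈P hamPt g → ∀ a → f a ≡ g a
hamPt-injective {f = f} {g} f≈g a = sym (unitVec≡1⇒≡ (begin
  unitVec (g a) (f a) ≡⟨ hamPt≡unitVec g a (f a) ⟨
  hamPt g a (f a)     ≡⟨ f≈g a (f a) ⟨
  hamPt f a (f a)     ≡⟨ hamPt≡unitVec f a (f a) ⟩
  unitVec (f a) (f a) ≡⟨ unitVec-diag (f a) ⟩
  1ℚ                  ∎))
  where open ≡-Reasoning

disagree : Fin n → Fin n → ℕ
disagree p q with p Fin.≟ q
... | yes _ = 0
... | no  _ = 1

disagree≤1 : (p q : Fin n) → disagree p q ℕ.≤ 1
disagree≤1 p q with p Fin.≟ q
... | yes _ = z≤n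
... | no  _ = s≤s z≤n

disagree-refl : (p : Fin n) → disagree p p ≡ 0
disagree-refl p with p Fin.≟ p
... | yes _   = refl
... | no  p≢p = ⊥-elim (p≢p refl)

disagree-≢ : {p q : Fin n} → p ≢ q → disagree p q ≡ 1
disagree-≢ {p = p} {q} p≢q with p Fin.≟ q
... | yes p≡q = ⊥-elim (p≢q p≡q)
... | no  _   = refl

hammingDist : (Fin m → Fin n) → (Fin m → Fin n) → ℕ
hammingDist {m} f g = Σℕ m (λ a → disagree (f a) (g a))

hammingDist≤ : (f g : Fin m → Fin n) → hammingDist f g ℕ.≤ m
hammingDist≤ {m} f g = Σℕ-≤ m _ (λ a → disagree≤1 (f a) (g a))

sqNorm-sub-unitVec-unitVec : (p q : Fin n) →
  sqNorm (unitVec p) + (1ℚ - (unitVec p q + unitVec p q)) ≡ ℕ→ℚ (2 ℕ.* disagree p q)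
sqNorm-sub-unitVec-unitVec p q rewrite sqNorm-unitVec p with p Fin.≟ q
... | yes _ = refl
... | no  _ = refl

sqDist-hamPt-hamPt : (f g : Fin m → Fin n) → sqDist (hamPt f) (hamPt g) ≡ ℕ→ℚ (2 ℕ.* hammingDist f g)
sqDist-hamPt-hamPt {m} {n} f g = begin
  sqDist (hamPt f) (hamPt g)
    ≡⟨ sqDist-cong (hamPt≡unitVec f) ≈P-refl ⟩
  sqDist (λ a → unitVec (f a)) (hamPt g)
    ≡⟨ sqDist-hamPt (λ a → unitVec (f a)) g ⟩
  Σℚ m (λ a → sqNorm (unitVec (f a)) + (1ℚ - (unitVec (f a) (g a) + unitVec (f a) (g a))))
    ≡⟨ Σℚ-cong m (λ a → sqNorm-sub-unitVec-unitVec (f a) (g a)) ⟩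
  Σℚ m (λ a → ℕ→ℚ (2 ℕ.* disagree (f a) (g a)))
    ≡⟨ ℕ→ℚ-Σℕ m _ ⟨
  ℕ→ℚ (Σℕ m (λ a → 2 ℕ.* disagree (f a) (g a)))
    ≡⟨ cong ℕ→ℚ (Σℕ-*ˡ m 2 _) ⟩
  ℕ→ℚ (2 ℕ.* hammingDist f g) ∎
  where open ≡-Reasoning

-- Distance sets containing H̃(n,m)

EvenUpTo : ℕ → ℚ → Set
EvenUpTo m d = Σ ℕ λ e → 1 ℕ.≤ e × e ℕ.≤ m × d ≡ ℕ→ℚ (2 ℕ.* e)

EvenUpTo-intro : ∀ {d} s → d ≢ 0ℚ → s ℕ.≤ m → d ≡ ℕ→ℚ (2 ℕ.* s) → EvenUpTo m d
EvenUpTo-intro zero    d≢0 _   d≡0 = ⊥-elim (d≢0 d≡0)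
EvenUpTo-intro (suc s) _   s≤m d≡2s = suc s , s≤s z≤n , s≤m , d≡2s

evens : ℕ → List ℚ
evens = applyUpTo (λ s → ℕ→ℚ (2 ℕ.* suc s))

length-evens : ∀ m → length (evens m) ≡ m
length-evens = List.length-applyUpTo _

evens-unique : ∀ m → Unique (evens m)
evens-unique m = applyUpTo⁺₁ _ m λ i<j _ eq →
  ℕP.<⇒≢ i<j (ℕP.suc-injective (ℕP.*-cancelˡ-≡ _ _ 2 (ℕ→ℚ-injective eq)))

∈-evens⁺ : ∀ {d} → EvenUpTo m d → d ∈ evens m
∈-evens⁺ (suc s , _ , s<m , refl) = ∈-applyUpTo⁺ _ s<m

∈-evens⁻ : ∀ {d} → d ∈ evens m → EvenUpTo m d
∈-evens⁻ d∈ with s , s<m , refl ← ∈-applyUpTo⁻ _ d∈ = suc s , s≤s z≤n , s<m , refl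

ladder : Fin n → Fin n → ℕ → Fin m → Fin n
ladder p q zero    a           = p
ladder p q (suc s) Fin.zero    = q
ladder p q (suc s) (Fin.suc a) = ladder p q s a

hammingDist-ladder : {p q : Fin n} → p ≢ q → ∀ s → s ℕ.≤ m →
  hammingDist {m} (λ _ → p) (ladder p q s) ≡ s
hammingDist-ladder {m = zero}  p≢q zero    z≤n       = refl
hammingDist-ladder {m = suc m} p≢q zero    z≤n       =
  cong₂ ℕ._+_ (disagree-refl _) (hammingDist-ladder {m = m} p≢q zero z≤n)
hammingDist-ladder {m = suc m} p≢q (suc s) (s≤s s≤m) =
  cong₂ ℕ._+_ (disagree-≢ p≢q) (hammingDist-ladder {m = m} p≢q s s≤m)

hamPt-realizes : 2 ℕ.≤ n → ∀ {d} → EvenUpTo m d →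
  ∃₂ λ (f g : Fin m → Fin n) → ¬ hamPt f ≈P hamPt g × sqDist (hamPt f) (hamPt g) ≡ d
hamPt-realizes (s≤s (s≤s _)) (s , 1≤s , s≤m , refl) = f , g , f≉g , f-g≡2s
  where
  f g : Fin _ → Fin _
  f _ = Fin.zero
  g   = ladder Fin.zero (Fin.suc Fin.zero) s
  f-g≡2s : sqDist (hamPt f) (hamPt g) ≡ ℕ→ℚ (2 ℕ.* s)
  f-g≡2s = trans (sqDist-hamPt-hamPt f g) (cong (λ h → ℕ→ℚ (2 ℕ.* h)) (hammingDist-ladder (λ ()) s s≤m))
  f≉g : ¬ hamPt f ≈P hamPt g
  f≉g f≈g = ℕP.<⇒≢ (ℕP.*-monoʳ-< 2 1≤s)
    (sym (ℕ→ℚ-injective (trans (sym f-g≡2s) (≈P⇒sqDist≡0 f≈g))))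

hamPt∈HamUnion : {x : Point m n} (f : Fin m → Fin n) → HamUnion m n x (hamPt f)
hamPt∈HamUnion f = inj₁ (f , ≈P-refl)

sqDist-hamPt-EvenUpTo : (f g : Fin m → Fin n) → ¬ hamPt f ≈P hamPt g →
  EvenUpTo m (sqDist (hamPt f) (hamPt g))
sqDist-hamPt-EvenUpTo f g f≉g = EvenUpTo-intro (hammingDist f g)
  (f≉g ∘ sqDist≡0⇒≈P (hamPt f) (hamPt g)) (hammingDist≤ f g) (sqDist-hamPt-hamPt f g)

HamUnion-sqDist-EvenUpTo : {x y z : Point m n} →
  (∀ f → ¬ x ≈P hamPt f → EvenUpTo m (sqDist x (hamPt f))) →
  HamUnion m n x y → HamUnion m n x z → ¬ y ≈P z → EvenUpTo m (sqDist y z)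
HamUnion-sqDist-EvenUpTo near (inj₁ (f , y≈f)) (inj₁ (g , z≈g)) y≉z =
  subst (EvenUpTo _) (sym (sqDist-cong y≈f z≈g))
    (sqDist-hamPt-EvenUpTo f g λ f≈g → y≉z (≈P-trans y≈f (≈P-trans f≈g (≈P-sym z≈g))))
HamUnion-sqDist-EvenUpTo {x = x} near (inj₁ (f , y≈f)) (inj₂ z≈x) y≉z =
  subst (EvenUpTo _) (sym (trans (sqDist-cong y≈f z≈x) (sqDist-sym (hamPt f) x)))
    (near f λ x≈f → y≉z (≈P-trans y≈f (≈P-trans (≈P-sym x≈f) (≈P-sym z≈x))))
HamUnion-sqDist-EvenUpTo near (inj₂ y≈x) (inj₁ (g , z≈g)) y≉z =
  subst (EvenUpTo _) (sym (sqDist-cong y≈x z≈g))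
    (near g λ x≈g → y≉z (≈P-trans y≈x (≈P-trans x≈g (≈P-sym z≈g))))
HamUnion-sqDist-EvenUpTo near (inj₂ y≈x) (inj₂ z≈x) y≉z = ⊥-elim (y≉z (≈P-trans y≈x (≈P-sym z≈x)))

HamUnion-isDistSet : 2 ℕ.≤ n → {x : Point m n} →
  (∀ f → ¬ x ≈P hamPt f → EvenUpTo m (sqDist x (hamPt f))) →
  IsDistSet (HamUnion m n x) m
HamUnion-isDistSet {m = m} 2≤n near =
  evens m , length-evens m , evens-unique m ,
  (λ y z y∈ z∈ y≉z → ∈-evens⁺ (HamUnion-sqDist-EvenUpTo near y∈ z∈ y≉z)) ,
  λ d d∈ → let f , g , f≉g , f-g≡d = hamPt-realizes 2≤n (∈-evens⁻ d∈)
           in hamPt f , hamPt g , hamPt∈HamUnion f , hamPt∈HamUnion g , f≉g , f-g≡d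

HamUnion-isDistSet⁻ : 2 ℕ.≤ n → {x : Point m n} → IsDistSet (HamUnion m n x) m →
  ∀ f → ¬ x ≈P hamPt f → EvenUpTo m (sqDist x (hamPt f))
HamUnion-isDistSet⁻ {m = m} 2≤n {x} (D , |D|≡m , _ , sqDist∈D , _) f x≉f =
  ∈-evens⁻ (D⊆evens (sqDist∈D x (hamPt f) (inj₂ ≈P-refl) (hamPt∈HamUnion f) x≉f))
  where
  evens⊆D : evens m ⊆ D
  evens⊆D d∈ with g , h , g≉h , g-h≡d ← hamPt-realizes 2≤n (∈-evens⁻ d∈) =
    subst (_∈ D) g-h≡d (sqDist∈D _ _ (hamPt∈HamUnion g) (hamPt∈HamUnion h) g≉h)
  D⊆evens : D ⊆ evens m
  D⊆evens = Unique-⊆-length⇒⊇ ℚP._≟_ (evens-unique m) evens⊆D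
    (ℕP.≤-reflexive (trans |D|≡m (sym (length-evens m))))

farthest-hamPt-≉ : 2 ℕ.≤ n → Fin m → {x : Point m n} {f : Fin m → Fin n} →
  (∀ g → sqDist x (hamPt g) ≤ sqDist x (hamPt f)) → ¬ x ≈P hamPt f
farthest-hamPt-≉ (s≤s (s≤s _)) a₀ {x} {f} farthest x≈f = other≢ (hamPt-injective {f = f} {g} f≈g a₀)
  where
  other : Fin _ → Fin _
  other Fin.zero    = Fin.suc Fin.zero
  other (Fin.suc _) = Fin.zero
  other≢ : ∀ {q} → q ≢ other q
  other≢ {Fin.zero}  ()
  other≢ {Fin.suc _} ()
  g : Fin _ → Fin _
  g _ = other (f a₀)
  x-f≡0 : sqDist x (hamPt f) ≡ 0ℚ
  x-f≡0 = ≈P⇒sqDist≡0 x≈f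
  x≈g : x ≈P hamPt g
  x≈g = sqDist≡0⇒≈P x (hamPt g)
    (ℚP.≤-antisym (subst (sqDist x (hamPt g) ≤_) x-f≡0 (farthest g)) (sqDist-nonneg x (hamPt g)))
  f≈g : hamPt f ≈P hamPt g
  f≈g = ≈P-trans (≈P-sym x≈f) x≈g

-- The points of 𝔛

ℕ→ℚ-count-suc : (c : Fin (suc n) → Fin t) (i : Fin t) →
  ℕ→ℚ (count c i) ≡ unitVec (c Fin.zero) i + ℕ→ℚ (count (c ∘ Fin.suc) i)
ℕ→ℚ-count-suc c i with c Fin.zero Fin.≟ i
... | yes _ = ℕ→ℚ-+ 1 (count (c ∘ Fin.suc) i)
... | no  _ = sym (ℚP.+-identityˡ _)

Σℚ-∘-count : ∀ n (c : Fin n → Fin t) (h : Fin t → ℚ) →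
  Σℚ n (h ∘ c) ≡ Σℚ t (λ i → ℕ→ℚ (count c i) * h i)
Σℚ-∘-count {t} zero c h = sym (trans (Σℚ-cong t λ i → ℚP.*-zeroˡ (h i)) (Σℚ-0 t))
Σℚ-∘-count {t} (suc n) c h = sym (begin
  Σℚ t (λ i → ℕ→ℚ (count c i) * h i)
    ≡⟨ Σℚ-cong t (λ i → trans (cong (_* h i) (ℕ→ℚ-count-suc c i)) (ℚP.*-distribʳ-+ (h i) (unitVec (c Fin.zero) i) (ℕ→ℚ (count (c ∘ Fin.suc) i)))) ⟩
  Σℚ t (λ i → unitVec (c Fin.zero) i * h i + ℕ→ℚ (count (c ∘ Fin.suc) i) * h i)
    ≡⟨ Σℚ-+ t _ _ ⟩
  Σℚ t (λ i → unitVec (c Fin.zero) i * h i) + Σℚ t (λ i → ℕ→ℚ (count (c ∘ Fin.suc) i) * h i)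
    ≡⟨ cong₂ _+_ (Σℚ-unitVec-* t (c Fin.zero) h) (sym (Σℚ-∘-count n (c ∘ Fin.suc) h)) ⟩
  h (c Fin.zero) + Σℚ n (h ∘ c ∘ Fin.suc) ∎)
  where open ≡-Reasoning

count≥1 : (c : Fin n → Fin t) (p : Fin n) → 1 ℕ.≤ count c (c p)
count≥1 c Fin.zero with c Fin.zero Fin.≟ c Fin.zero
... | yes _   = s≤s z≤n
... | no  c≢c = ⊥-elim (c≢c refl)
count≥1 c (Fin.suc p) with c Fin.zero Fin.≟ c (Fin.suc p)
... | yes _ = s≤s z≤n
... | no  _ = count≥1 (c ∘ Fin.suc) p

count≥1⇒preimage : (c : Fin n → Fin t) (i : Fin t) → 1 ℕ.≤ count c i → ∃ λ p → c p ≡ i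
count≥1⇒preimage {zero}  c i ()
count≥1⇒preimage {suc n} c i 1≤count with c Fin.zero Fin.≟ i
... | yes c₀≡i = Fin.zero , c₀≡i
... | no  _    = let p , cp≡i = count≥1⇒preimage (c ∘ Fin.suc) i 1≤count in Fin.suc p , cp≡i

+-cancelˡ-≤ : ∀ r {p q} → r + p ≤ r + q → p ≤ q
+-cancelˡ-≤ r {p} {q} r+p≤r+q =
  subst₂ _≤_ (sym (cancel r p)) (sym (cancel r q)) (ℚP.+-monoʳ-≤ (- r) r+p≤r+q)
  where
  cancel : ∀ x y → y ≡ - x + (x + y)
  cancel = solve-∀ ℚ-ring

k0/n : (n t : ℕ) → (Fin t → ℕ) → ℚ
k0/n n t k = k0 t k /ℕ n

levelNorm : (n t : ℕ) → (Fin t → ℕ) → ℚ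
levelNorm n t k = Σℚ t λ i →
  ℕ→ℚ (k i) * ((k0/n n t k - ℕ→ℚ (toℕ i)) * (k0/n n t k - ℕ→ℚ (toℕ i)))

blockOffset : (n t : ℕ) → (Fin t → ℕ) → ℚ
blockOffset n t k = levelNorm n t k + (1ℚ - (k0/n n t k + k0/n n t k))

sqNorm-InX1 : {k : Fin t → ℕ} {v : Fin n → ℚ} → InX1 n t k v → sqNorm v ≡ levelNorm n t k
sqNorm-InX1 {t} {n} {k} {v} (c , count≡k , v≡) = begin
  Σℚ n (λ b → v b * v b)  ≡⟨ Σℚ-cong n (λ b → cong₂ _*_ (v≡ b) (v≡ b)) ⟩
  Σℚ n (h ∘ c)            ≡⟨ Σℚ-∘-count n c h ⟩
  Σℚ t (λ i → ℕ→ℚ (count c i) * h i) ≡⟨ Σℚ-cong t (λ i → cong (λ ki → ℕ→ℚ ki * h i) (count≡k i)) ⟩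
  levelNorm n t k         ∎
  where
  open ≡-Reasoning
  h : Fin t → ℚ
  h i = (k0/n n t k - ℕ→ℚ (toℕ i)) * (k0/n n t k - ℕ→ℚ (toℕ i))

sqNorm-sub-unitVec-InX1 : {k : Fin t → ℕ} {v : Fin n → ℚ} (hv : InX1 n t k v) (q : Fin n) →
  sqNorm v + (1ℚ - (v q + v q)) ≡ blockOffset n t k + ℕ→ℚ (2 ℕ.* toℕ (proj₁ hv q))
sqNorm-sub-unitVec-InX1 {t} {n} {k} hv@(c , _ , v≡) q = begin
  _ ≡⟨ cong₂ (λ s w → s + (1ℚ - (w + w))) (sqNorm-InX1 hv) (v≡ q) ⟩
  levelNorm n t k + (1ℚ - ((K - L) + (K - L))) ≡⟨ regroup (levelNorm n t k) K L ⟩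
  blockOffset n t k + (L + L)                  ≡⟨ cong (blockOffset n t k +_) (ℕ→ℚ-double (toℕ (c q))) ⟨
  _ ∎
  where
  open ≡-Reasoning
  K = k0/n n t k
  L = ℕ→ℚ (toℕ (c q))
  regroup : ∀ N K L → N + (1ℚ - ((K - L) + (K - L))) ≡ (N + (1ℚ - (K + K))) + (L + L)
  regroup = solve-∀ ℚ-ring

module _ {m n : ℕ} {t : Fin m → ℕ} {k : (j : Fin m) → Fin (t j) → ℕ} where

  offset : ℚ
  offset = Σℚ m (λ a → blockOffset n (t a) (k a))

  levelSum : {x : Point m n} → InX m n t k x → (Fin m → Fin n) → ℕ
  levelSum hx f = Σℕ m (λ a → toℕ (proj₁ (hx a) (f a)))

  sqDist-InX-hamPt : {x : Point m n} (hx : InX m n t k x) (f : Fin m → Fin n) →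
    sqDist x (hamPt f) ≡ offset + ℕ→ℚ (2 ℕ.* levelSum hx f)
  sqDist-InX-hamPt {x} hx f = begin
    sqDist x (hamPt f)
      ≡⟨ sqDist-hamPt x f ⟩
    Σℚ m (λ a → sqNorm (x a) + (1ℚ - (x a (f a) + x a (f a))))
      ≡⟨ Σℚ-cong m (λ a → sqNorm-sub-unitVec-InX1 (hx a) (f a)) ⟩
    Σℚ m (λ a → blockOffset n (t a) (k a) + ℕ→ℚ (2 ℕ.* level a))
      ≡⟨ Σℚ-+ m _ _ ⟩
    offset + Σℚ m (λ a → ℕ→ℚ (2 ℕ.* level a))
      ≡⟨ cong (offset +_) (ℕ→ℚ-Σℕ m _) ⟨
    offset + ℕ→ℚ (Σℕ m (λ a → 2 ℕ.* level a))
      ≡⟨ cong (λ s → offset + ℕ→ℚ s) (Σℕ-*ˡ m 2 level) ⟩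
    offset + ℕ→ℚ (2 ℕ.* levelSum hx f) ∎
    where
    open ≡-Reasoning
    level : Fin m → ℕ
    level a = toℕ (proj₁ (hx a) (f a))

  levelSum-transfer : {x y : Point m n} (hx : InX m n t k x) (hy : InX m n t k y) (f : Fin m → Fin n) →
    ∃ λ g → levelSum hx f ≡ levelSum hy g
  -- x and y have the same level multiplicities, so a level that x uses in a block also
  -- occurs in the corresponding block of y.
  levelSum-transfer hx hy f = proj₁ ∘ preimage , Σℕ-cong m (λ a → cong toℕ (sym (proj₂ (preimage a))))
    where
    preimage : ∀ a → ∃ λ p → proj₁ (hy a) p ≡ proj₁ (hx a) (f a)
    preimage a = count≥1⇒preimage cy i (subst (1 ℕ.≤_) (trans (cx≡k i) (sym (cy≡k i))) (count≥1 cx (f a)))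
      where
      cx = proj₁ (hx a)
      cy = proj₁ (hy a)
      cx≡k = proj₁ (proj₂ (hx a))
      cy≡k = proj₁ (proj₂ (hy a))
      i = cx (f a)

  InX-sqDist-gap : {x₀ x : Point m n} {M : ℚ} → InX m n t k x₀ → IsMaxSqDist m n x₀ M →
    InX m n t k x → ∀ f → ∃ λ d → sqDist x (hamPt f) + ℕ→ℚ (2 ℕ.* d) ≡ M
  InX-sqDist-gap {x₀} {x} {M} hx₀ ((f* , x₀-f*≡M) , farthest) hx f = N* ℕ.∸ N , (begin
    sqDist x (hamPt f) + ℕ→ℚ (2 ℕ.* d)
      ≡⟨ cong (_+ ℕ→ℚ (2 ℕ.* d)) (trans (sqDist-InX-hamPt hx f) (cong (λ s → offset + ℕ→ℚ (2 ℕ.* s)) N≡)) ⟩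
    offset + ℕ→ℚ (2 ℕ.* N) + ℕ→ℚ (2 ℕ.* d)
      ≡⟨ ℚP.+-assoc offset _ _ ⟩
    offset + (ℕ→ℚ (2 ℕ.* N) + ℕ→ℚ (2 ℕ.* d))
      ≡⟨ cong (offset +_) (ℕ→ℚ-+ (2 ℕ.* N) (2 ℕ.* d)) ⟨
    offset + ℕ→ℚ (2 ℕ.* N ℕ.+ 2 ℕ.* d)
      ≡⟨ cong (λ s → offset + ℕ→ℚ s) 2N+2d≡2N* ⟩
    offset + ℕ→ℚ (2 ℕ.* N*)
      ≡⟨ trans (sym x₀-f*≡M) (sqDist-InX-hamPt hx₀ f*) ⟨
    M ∎)
    where
    open ≡-Reasoning
    transfer = levelSum-transfer hx hx₀ f
    g = proj₁ transfer
    N≡ = proj₂ transfer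
    N  = levelSum hx₀ g
    N* = levelSum hx₀ f*
    d  = N* ℕ.∸ N
    N≤N* : N ℕ.≤ N*
    N≤N* = ℕP.*-cancelˡ-≤ 2 (ℕ→ℚ-cancel-≤ (+-cancelˡ-≤ offset (subst₂ _≤_
      (sqDist-InX-hamPt hx₀ g) (trans (sym x₀-f*≡M) (sqDist-InX-hamPt hx₀ f*)) (farthest g))))
    2N+2d≡2N* : 2 ℕ.* N ℕ.+ 2 ℕ.* d ≡ 2 ℕ.* N*
    2N+2d≡2N* = trans (sym (ℕP.*-distribˡ-+ 2 N d)) (cong (2 ℕ.*_) (ℕP.m+[n∸m]≡n N≤N*))

  InX-sqDist-EvenUpTo : {x₀ x : Point m n} {M : ℚ} → InX m n t k x₀ → IsMaxSqDist m n x₀ M →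
    EvenUpTo m M → InX m n t k x → ∀ f → ¬ x ≈P hamPt f → EvenUpTo m (sqDist x (hamPt f))
  InX-sqDist-EvenUpTo {x = x} hx₀ isMax (e , _ , e≤m , M≡2e) hx f x≉f =
    EvenUpTo-intro (e ℕ.∸ d) (x≉f ∘ sqDist≡0⇒≈P x (hamPt f)) (ℕP.≤-trans (ℕP.m∸n≤m e d) e≤m) (begin
      sqDist x (hamPt f)               ≡⟨ +-ℕ→ℚ⇒≡∸ (2 ℕ.* d) (2 ℕ.* e) (sqDist-nonneg x (hamPt f)) (trans gap M≡2e) ⟩
      ℕ→ℚ (2 ℕ.* e ℕ.∸ 2 ℕ.* d)        ≡⟨ cong ℕ→ℚ (ℕP.*-distribˡ-∸ 2 e d) ⟨
      ℕ→ℚ (2 ℕ.* (e ℕ.∸ d))            ∎)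
    where
    open ≡-Reasoning
    d = proj₁ (InX-sqDist-gap hx₀ isMax hx f)
    gap = proj₂ (InX-sqDist-gap hx₀ isMax hx f)

lemma4p1 : (n m : ℕ) → 2 ℕ.≤ n → 1 ℕ.≤ m →
    (t : Fin m → ℕ) → (∀ j → 1 ℕ.≤ t j) → (∀ j → t j ℕ.≤ m) →
    (k : (j : Fin m) → Fin (t j) → ℕ) → (∀ j → Σℕ (t j) (k j) ≡ n) →
    (x₀ : Point m n) → InX m n t k x₀ →
    (M : ℚ) → IsMaxSqDist m n x₀ M →
    ((∀ (x : Point m n) → InX m n t k x → IsDistSet (HamUnion m n x) m)
      ⇔ Σ ℕ (λ e → 1 ℕ.≤ e × e ℕ.≤ m × M ≡ ℕ→ℚ (2 ℕ.* e)))
lemma4p1 n (suc m) 2≤n _ _ _ _ _ _ x₀ hx₀ M isMax@((f* , x₀-f*≡M) , farthest) = mk⇔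
  (λ distSet → subst (EvenUpTo (suc m)) x₀-f*≡M
    (HamUnion-isDistSet⁻ 2≤n (distSet x₀ hx₀) f*
      (farthest-hamPt-≉ 2≤n Fin.zero {f = f*} λ g → subst (sqDist x₀ (hamPt g) ≤_) (sym x₀-f*≡M) (farthest g))))
  (λ evenM x hx → HamUnion-isDistSet 2≤n (InX-sqDist-EvenUpTo hx₀ isMax evenM hx))
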